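{- Let $n\ge 1$ and let $G$ be a simple loopless undirected graph on $n$ vertices that is $(\mathbb{Z}_2,+)$-cordial. If $n=2k$ is even, then $G$ has at most $2k^2-2k+1$ edges; if $n=2k+1$ is odd, then $G$ has at most $2k^2+1$ edges.
   Context: A labeling $f:\mathcal{Z}\to\{0,1\}$ of a finite set $\mathcal{Z}$ is friendly if $-1\le |f^{ -1}(0)|-|f^{ -1}(1)|\le 1$. An undirected graph $G=(V,E)$ is $(\mathbb{Z}_2,+)$-cordial if there is a friendly labeling $f$ of the non-isolated vertices of $G$ with labels in $\{0,1\}$ such that the induced edge labeling $g(uv)=f(u)+f(v) \pmod 2$ is a friendly labeling of $E$ (i.e. the numbers of edges labeled $0$ and labeled $1$ differ by at most one). -}

module Defs where

open import Data.Nat using (ℕ; zero; suc; _+_; _≤_; _<ᵇ_)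
open import Data.Bool using (Bool; true; false; if_then_else_; _∧_; _xor_; not)
open import Data.Fin using (Fin; toℕ)
open import Data.List using (List; []; _∷_; allFin; cartesianProduct)
open import Data.Bool.ListAction using (any)
open import Data.Product using (_×_; _,_; Σ)
open import Relation.Binary.PropositionalEquality using (_≡_)

record SimpleGraph (n : ℕ) : Set where
  field
    adj    : Fin n → Fin n → Bool
    sym    : ∀ i j → adj i j ≡ adj j i
    irrefl : ∀ i → adj i i ≡ false
open SimpleGraph public

count : {A : Set} → (A → Bool) → List A → ℕ
count p [] = 0
count p (x ∷ xs) = if p x then suc (count p xs) else count p xs

allPairs : (n : ℕ) → List (Fin n × Fin n)
allPairs n = cartesianProduct (allFin n) (allFin n)

-- an edge {i,j} is represented once, by the pair with toℕ i < toℕ j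
isEdge : ∀ {n} → SimpleGraph n → Fin n × Fin n → Bool
isEdge G (i , j) = (toℕ i <ᵇ toℕ j) ∧ adj G i j

edgeCount : ∀ {n} → SimpleGraph n → ℕ
edgeCount {n} G = count (isEdge G) (allPairs n)

nonIsolated : ∀ {n} → SimpleGraph n → Fin n → Bool
nonIsolated {n} G i = any (adj G i) (allFin n)

Friendly : ℕ → ℕ → Set
Friendly a b = (a ≤ suc b) × (b ≤ suc a)

-- number of non-isolated vertices with label ℓ (false = 0, true = 1)
vertexLabelCount : ∀ {n} → SimpleGraph n → (Fin n → Bool) → Bool → ℕ
vertexLabelCount {n} G f ℓ =
  count (λ i → nonIsolated G i ∧ not (f i xor ℓ)) (allFin n)

edgeLabelCount : ∀ {n} → SimpleGraph n → (Fin n → Bool) → Bool → ℕ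
edgeLabelCount {n} G f ℓ =
  count (λ { (i , j) → isEdge G (i , j) ∧ not ((f i xor f j) xor ℓ) }) (allPairs n)

-- (Z₂,+)-cordial: some labeling f (only its values on non-isolated vertices matter)
-- is friendly on the non-isolated vertices and induces a friendly edge labeling.
Z2Cordial : ∀ {n} → SimpleGraph n → Set
Z2Cordial {n} G = Σ (Fin n → Bool) λ f →
  Friendly (vertexLabelCount G f false) (vertexLabelCount G f true)
  × Friendly (edgeLabelCount G f false) (edgeLabelCount G f true)

{-# OPTIONS --safe #-}
module Submission where

-- Edges labelled 0 join two vertices with the same label, both non-isolated; so if a and b
-- non-isolated vertices are labelled 0 and 1 there are at most C(a,2) + C(b,2) such edges.
-- Friendliness on vertices gives |a - b| ≤ 1 and a + b ≤ n, which caps this at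
-- C(⌊n/2⌋,2) + C(⌈n/2⌉,2); friendliness on edges then bounds |E| by twice that plus one,
-- i.e. by 2k² - 2k + 1 for n = 2k and by 2k² + 1 for n = 2k + 1.

open import Defs hiding (sym)
open import Data.Nat using (ℕ; zero; suc; _+_; _*_; _∸_; _≤_; _<ᵇ_; z≤n; s≤s; ⌊_/2⌋; ⌈_/2⌉)
open import Data.Nat.Properties
open import Data.Nat.Combinatorics using (_C_; nC1≡n; nCk+nC[k+1]≡[n+1]C[k+1])
open import Data.Bool using (Bool; true; false; T; _∧_; _xor_; not)
open import Data.Fin using (Fin; toℕ; zero; suc)
open import Data.List using (List; []; _∷_; _++_; map; length; tabulate; allFin; cartesianProduct)
open import Data.List.Properties using (length-tabulate)
open import Data.List.Relation.Unary.Any.Properties using (any⁺)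
open import Data.List.Membership.Propositional using (lose)
open import Data.List.Membership.Propositional.Properties using (∈-allFin)
open import Data.Product using (_×_; _,_)
open import Data.Sum using (_⊎_; inj₁; inj₂)
open import Data.Empty using (⊥-elim)
open import Function using (_∘_; id)
open import Relation.Nullary using (¬_)
open import Relation.Binary.Definitions using (tri<; tri≈; tri>)
open import Relation.Binary.PropositionalEquality
  using (_≡_; refl; sym; trans; cong; cong₂; subst; module ≡-Reasoning)
open import Algebra.Properties.Monoid.Sum +-0-monoid
  using (sum-syntax; sum-cong-≗; sum-replicate-zero)
open import Algebra.Properties.CommutativeSemigroup +-commutativeSemigroup
  using (interchange)
open import Data.Nat.Tactic.RingSolver using (solve-∀)

[_] : Bool → ℕ
[ true ]  = 1
[ false ] = 0

[]-≤-+ : ∀ {a b c} → (T a → T b ⊎ T c) → [ a ] ≤ [ b ] + [ c ]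
[]-≤-+ {false}                 h = z≤n
[]-≤-+ {true} {true}           h = s≤s z≤n
[]-≤-+ {true} {false} {true}   h = s≤s z≤n
[]-≤-+ {true} {false} {false}  h with h _
... | inj₁ ()
... | inj₂ ()

[]-+-≤-1 : ∀ {a b} → (T a → ¬ T b) → [ a ] + [ b ] ≤ 1
[]-+-≤-1 {false} {false} h = z≤n
[]-+-≤-1 {false} {true}  h = s≤s z≤n
[]-+-≤-1 {true}  {false} h = s≤s z≤n
[]-+-≤-1 {true}  {true}  h with h _ _
... | ()

module _ {A : Set} where

  count-∷ : (p : A → Bool) (x : A) (xs : List A) →
            count p (x ∷ xs) ≡ [ p x ] + count p xs
  count-∷ p x xs with p x
  ... | true  = refl
  ... | false = refl

  count-++ : (p : A → Bool) (xs ys : List A) →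
             count p (xs ++ ys) ≡ count p xs + count p ys
  count-++ p []       ys = refl
  count-++ p (x ∷ xs) ys with p x
  ... | true  = cong suc (count-++ p xs ys)
  ... | false = count-++ p xs ys

  count-map : {B : Set} (p : B → Bool) (g : A → B) (xs : List A) →
              count p (map g xs) ≡ count (p ∘ g) xs
  count-map p g []       = refl
  count-map p g (x ∷ xs) with p (g x)
  ... | true  = cong suc (count-map p g xs)
  ... | false = count-map p g xs

  count-≤-+ : {p q r : A → Bool} → (∀ x → T (p x) → T (q x) ⊎ T (r x)) →
              ∀ xs → count p xs ≤ count q xs + count r xs
  count-≤-+                 h []       = z≤n
  count-≤-+ {p} {q} {r} h (x ∷ xs) = begin
    count p (x ∷ xs)                                ≡⟨ count-∷ p x xs ⟩
    [ p x ] + count p xs                            ≤⟨ +-mono-≤ ([]-≤-+ (h x)) (count-≤-+ h xs) ⟩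
    ([ q x ] + [ r x ]) + (count q xs + count r xs) ≡⟨ interchange [ q x ] [ r x ] _ _ ⟩
    ([ q x ] + count q xs) + ([ r x ] + count r xs) ≡⟨ sym (cong₂ _+_ (count-∷ q x xs) (count-∷ r x xs)) ⟩
    count q (x ∷ xs) + count r (x ∷ xs)             ∎
    where open ≤-Reasoning

  count-+-≤-length : {p q : A → Bool} → (∀ x → T (p x) → ¬ T (q x)) →
                     ∀ xs → count p xs + count q xs ≤ length xs
  count-+-≤-length         h []       = z≤n
  count-+-≤-length {p} {q} h (x ∷ xs) = begin
    count p (x ∷ xs) + count q (x ∷ xs)             ≡⟨ cong₂ _+_ (count-∷ p x xs) (count-∷ q x xs) ⟩
    ([ p x ] + count p xs) + ([ q x ] + count q xs) ≡⟨ interchange [ p x ] _ [ q x ] _ ⟩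
    ([ p x ] + [ q x ]) + (count p xs + count q xs) ≤⟨ +-mono-≤ ([]-+-≤-1 (h x)) (count-+-≤-length h xs) ⟩
    suc (length xs)                                 ∎
    where open ≤-Reasoning

count-tabulate : ∀ {A : Set} {n} (p : A → Bool) (g : Fin n → A) →
                 count p (tabulate g) ≡ ∑[ i < n ] [ p (g i) ]
count-tabulate {n = zero}  p g = refl
count-tabulate {n = suc n} p g =
  trans (count-∷ p (g zero) (tabulate (g ∘ suc))) (cong ([ p (g zero) ] +_) (count-tabulate p (g ∘ suc)))

count-cartesianProduct : ∀ {A B : Set} {n} (p : A × B → Bool) (g : Fin n → A) (ys : List B) →
  count p (cartesianProduct (tabulate g) ys) ≡ ∑[ i < n ] count (λ y → p (g i , y)) ys
count-cartesianProduct {n = zero}  p g ys = refl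
count-cartesianProduct {n = suc n} p g ys =
  trans (count-++ p (map (g zero ,_) ys) _)
        (cong₂ _+_ (count-map p (g zero ,_) ys) (count-cartesianProduct p (g ∘ suc) ys))

count-allPairs : ∀ {n} (p : Fin n × Fin n → Bool) →
                 count p (allPairs n) ≡ ∑[ i < n ] ∑[ j < n ] [ p (i , j) ]
count-allPairs {n} p =
  trans (count-cartesianProduct p id (allFin n))
        (sum-cong-≗ (λ i → count-tabulate (λ j → p (i , j)) id))

C2-suc : ∀ c → suc c C 2 ≡ c + c C 2
C2-suc c = trans (sym (nCk+nC[k+1]≡[n+1]C[k+1] c 1)) (cong (_+ c C 2) (nC1≡n c))

C2-mono : ∀ {a b} → a ≤ b → a C 2 ≤ b C 2
C2-mono z≤n = z≤n
C2-mono (s≤s {a} {b} a≤b) = begin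
  suc a C 2   ≡⟨ C2-suc a ⟩
  a + a C 2   ≤⟨ +-mono-≤ a≤b (C2-mono a≤b) ⟩
  b + b C 2   ≡⟨ C2-suc b ⟨
  suc b C 2   ∎
  where open ≤-Reasoning

C2+C2+n≡n*n : ∀ n → n C 2 + n C 2 + n ≡ n * n
C2+C2+n≡n*n zero    = refl
C2+C2+n≡n*n (suc n) = begin
  suc n C 2 + suc n C 2 + suc n    ≡⟨ cong (λ m → m + m + suc n) (C2-suc n) ⟩
  (n + c) + (n + c) + suc n        ≡⟨ regroup n c ⟩
  (c + c + n) + (n + suc n)        ≡⟨ cong (_+ (n + suc n)) (C2+C2+n≡n*n n) ⟩
  n * n + (n + suc n)              ≡⟨ square-suc n ⟩
  suc n * suc n                    ∎
  where
  open ≡-Reasoning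
  c = n C 2
  regroup : ∀ n c → (n + c) + (n + c) + suc n ≡ (c + c + n) + (n + suc n)
  regroup = solve-∀
  square-suc : ∀ n → n * n + (n + suc n) ≡ suc n * suc n
  square-suc = solve-∀

increasingPair : ∀ {n} → (Fin n → Bool) → Fin n × Fin n → Bool
increasingPair s (i , j) = (toℕ i <ᵇ toℕ j) ∧ (s i ∧ s j)

∑-increasingPair : ∀ {n} (s : Fin n → Bool) →
  ∑[ i < n ] ∑[ j < n ] [ increasingPair s (i , j) ] ≡ (∑[ i < n ] [ s i ]) C 2
∑-increasingPair {zero}  s = refl
∑-increasingPair {suc n} s with s zero
... | true  = trans (cong (∑[ i < n ] [ s (suc i) ] +_) (∑-increasingPair (s ∘ suc)))
                    (sym (C2-suc (∑[ i < n ] [ s (suc i) ])))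
... | false = trans (cong (_+ ∑[ i < n ] ∑[ j < n ] [ increasingPair (s ∘ suc) (i , j) ])
                           (sum-replicate-zero n))
                    (∑-increasingPair (s ∘ suc))

count-increasingPair : ∀ {n} (s : Fin n → Bool) →
                       count (increasingPair s) (allPairs n) ≡ count s (allFin n) C 2
count-increasingPair s = begin
  count (increasingPair s) (allPairs _)                ≡⟨ count-allPairs (increasingPair s) ⟩
  ∑[ i < _ ] ∑[ j < _ ] [ increasingPair s (i , j) ]   ≡⟨ ∑-increasingPair s ⟩
  (∑[ i < _ ] [ s i ]) C 2                             ≡⟨ cong (_C 2) (count-tabulate s id) ⟨
  count s (allFin _) C 2                               ∎
  where open ≡-Reasoning

pairsWithinHalves : ℕ → ℕ
pairsWithinHalves m = ⌊ m /2⌋ C 2 + ⌈ m /2⌉ C 2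

pairsWithinHalves-mono : ∀ {m m′} → m ≤ m′ → pairsWithinHalves m ≤ pairsWithinHalves m′
pairsWithinHalves-mono m≤m′ = +-mono-≤ (C2-mono (⌊n/2⌋-mono m≤m′)) (C2-mono (⌈n/2⌉-mono m≤m′))

pairsWithinHalves-double : ∀ a → pairsWithinHalves (a + a) ≡ a C 2 + a C 2
pairsWithinHalves-double a =
  sym (cong₂ (λ x y → x C 2 + y C 2) (n≡⌊n+n/2⌋ a) (n≡⌈n+n/2⌉ a))

pairsWithinHalves-double+1 : ∀ a → pairsWithinHalves (suc (a + a)) ≡ a C 2 + suc a C 2
pairsWithinHalves-double+1 a =
  sym (cong₂ (λ x y → x C 2 + suc y C 2) (n≡⌈n+n/2⌉ a) (n≡⌊n+n/2⌋ a))

C2+C2≡pairsWithinHalves : ∀ {a b} → a ≤ suc b → b ≤ suc a →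
                          a C 2 + b C 2 ≡ pairsWithinHalves (a + b)
C2+C2≡pairsWithinHalves {a} {b} a≤1+b b≤1+a with <-cmp a b
... | tri≈ _ refl _ = sym (pairsWithinHalves-double a)
... | tri< a<b _ _ rewrite ≤-antisym b≤1+a a<b =
  trans (sym (pairsWithinHalves-double+1 a)) (cong pairsWithinHalves (sym (+-suc a a)))
... | tri> _ _ b<a rewrite ≤-antisym a≤1+b b<a =
  trans (+-comm (suc b C 2) (b C 2)) (sym (pairsWithinHalves-double+1 b))

pairsWithinHalves-even : ∀ k → pairsWithinHalves (2 * k) + k ≡ k * k
pairsWithinHalves-even k = begin
  pairsWithinHalves (2 * k) + k   ≡⟨ cong (λ m → pairsWithinHalves (k + m) + k) (+-identityʳ k) ⟩
  pairsWithinHalves (k + k) + k   ≡⟨ cong (_+ k) (pairsWithinHalves-double k) ⟩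
  k C 2 + k C 2 + k               ≡⟨ C2+C2+n≡n*n k ⟩
  k * k                           ∎
  where open ≡-Reasoning

pairsWithinHalves-odd : ∀ k → pairsWithinHalves (2 * k + 1) ≡ k * k
pairsWithinHalves-odd k = begin
  pairsWithinHalves (2 * k + 1)        ≡⟨ cong pairsWithinHalves 2k+1≡1+[k+k] ⟩
  pairsWithinHalves (suc (k + k))      ≡⟨ pairsWithinHalves-double+1 k ⟩
  k C 2 + suc k C 2                    ≡⟨ cong (k C 2 +_) (trans (C2-suc k) (+-comm k (k C 2))) ⟩
  k C 2 + (k C 2 + k)                  ≡⟨ +-assoc (k C 2) (k C 2) k ⟨
  k C 2 + k C 2 + k                    ≡⟨ C2+C2+n≡n*n k ⟩
  k * k                                ∎
  where
  open ≡-Reasoning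
  2k+1≡1+[k+k] : 2 * k + 1 ≡ suc (k + k)
  2k+1≡1+[k+k] = trans (+-comm (2 * k) 1) (cong (λ m → suc (k + m)) (+-identityʳ k))

module _ {n} (G : SimpleGraph n) (f : Fin n → Bool) where

  labelClass : Bool → Fin n → Bool
  labelClass ℓ i = nonIsolated G i ∧ not (f i xor ℓ)

  adj⇒nonIsolated : ∀ i j → T (adj G i j) → T (nonIsolated G i)
  adj⇒nonIsolated i j ij = any⁺ (adj G i) (lose (∈-allFin j) ij)

  adj⇒nonIsolatedʳ : ∀ i j → T (adj G i j) → T (nonIsolated G j)
  adj⇒nonIsolatedʳ i j = adj⇒nonIsolated j i ∘ subst T (SimpleGraph.sym G i j)

  sameLabel⇒monochromatic : ∀ i j → T (isEdge G (i , j) ∧ not ((f i xor f j) xor false)) →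
    T (increasingPair (labelClass false) (i , j)) ⊎ T (increasingPair (labelClass true) (i , j))
  sameLabel⇒monochromatic i j
    with toℕ i <ᵇ toℕ j | adj G i j | nonIsolated G i | nonIsolated G j
       | adj⇒nonIsolated i j | adj⇒nonIsolatedʳ i j | f i | f j
  ... | false | _     | _     | _     | _   | _   | _     | _     = λ ()
  ... | true  | false | _     | _     | _   | _   | _     | _     = λ ()
  ... | true  | true  | false | _     | i∉ | _   | _     | _     = ⊥-elim (i∉ _)
  ... | true  | true  | true  | false | _   | j∉ | _     | _     = ⊥-elim (j∉ _)
  ... | true  | true  | true  | true  | _   | _   | false | false = λ _ → inj₁ _
  ... | true  | true  | true  | true  | _   | _   | true  | true  = λ _ → inj₂ _
  ... | true  | true  | true  | true  | _   | _   | false | true  = λ ()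
  ... | true  | true  | true  | true  | _   | _   | true  | false = λ ()

  edge⇒labelled : ∀ i j → T (isEdge G (i , j)) →
    T (isEdge G (i , j) ∧ not ((f i xor f j) xor false)) ⊎ T (isEdge G (i , j) ∧ not ((f i xor f j) xor true))
  edge⇒labelled i j with isEdge G (i , j) | f i | f j
  ... | false | _     | _     = λ ()
  ... | true  | false | false = inj₁
  ... | true  | true  | true  = inj₁
  ... | true  | false | true  = inj₂
  ... | true  | true  | false = inj₂

  labelClasses-disjoint : ∀ i → T (labelClass false i) → ¬ T (labelClass true i)
  labelClasses-disjoint i with nonIsolated G i | f i
  ... | false | _     = λ ()
  ... | true  | false = λ _ ()
  ... | true  | true  = λ ()

  edgeCount≤edgeLabelCounts : edgeCount G ≤ edgeLabelCount G f false + edgeLabelCount G f true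
  edgeCount≤edgeLabelCounts = count-≤-+ (λ { (i , j) → edge⇒labelled i j }) (allPairs n)

  edgeLabelCount-false≤C2+C2 : edgeLabelCount G f false ≤
                          vertexLabelCount G f false C 2 + vertexLabelCount G f true C 2
  edgeLabelCount-false≤C2+C2 = begin
    edgeLabelCount G f false
      ≤⟨ count-≤-+ (λ { (i , j) → sameLabel⇒monochromatic i j }) (allPairs n) ⟩
    count (increasingPair (labelClass false)) (allPairs n) + count (increasingPair (labelClass true)) (allPairs n)
      ≡⟨ cong₂ _+_ (count-increasingPair (labelClass false)) (count-increasingPair (labelClass true)) ⟩
    vertexLabelCount G f false C 2 + vertexLabelCount G f true C 2 ∎
    where open ≤-Reasoning

  vertexLabelCounts≤n : vertexLabelCount G f false + vertexLabelCount G f true ≤ n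
  vertexLabelCounts≤n = begin
    vertexLabelCount G f false + vertexLabelCount G f true ≤⟨ count-+-≤-length labelClasses-disjoint (allFin n) ⟩
    length (allFin n)                                     ≡⟨ length-tabulate id ⟩
    n                                                     ∎
    where open ≤-Reasoning

cordial⇒edgeCount≤ : ∀ {n} (G : SimpleGraph n) → Z2Cordial G →
                     edgeCount G ≤ 2 * pairsWithinHalves n + 1
cordial⇒edgeCount≤ {n} G (f , (v₀≤1+v₁ , v₁≤1+v₀) , (_ , e₁≤1+e₀)) = begin
  edgeCount G                   ≤⟨ edgeCount≤edgeLabelCounts G f ⟩
  e₀ + e₁                       ≤⟨ +-monoʳ-≤ e₀ e₁≤1+e₀ ⟩
  e₀ + suc e₀                   ≡⟨ x+[1+x]≡2x+1 e₀ ⟩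
  2 * e₀ + 1                    ≤⟨ +-monoˡ-≤ 1 (*-monoʳ-≤ 2 e₀≤pairsWithinHalves) ⟩
  2 * pairsWithinHalves n + 1   ∎
  where
  open ≤-Reasoning
  e₀ = edgeLabelCount G f false
  e₁ = edgeLabelCount G f true
  v₀ = vertexLabelCount G f false
  v₁ = vertexLabelCount G f true
  x+[1+x]≡2x+1 : ∀ x → x + suc x ≡ 2 * x + 1
  x+[1+x]≡2x+1 = solve-∀
  e₀≤pairsWithinHalves : e₀ ≤ pairsWithinHalves n
  e₀≤pairsWithinHalves = begin
    e₀                               ≤⟨ edgeLabelCount-false≤C2+C2 G f ⟩
    v₀ C 2 + v₁ C 2                  ≡⟨ C2+C2≡pairsWithinHalves v₀≤1+v₁ v₁≤1+v₀ ⟩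
    pairsWithinHalves (v₀ + v₁)      ≤⟨ pairsWithinHalves-mono (vertexLabelCounts≤n G f) ⟩
    pairsWithinHalves n              ∎

twice-pairsWithinHalves-even : ∀ k → 2 * pairsWithinHalves (2 * k) ≡ 2 * k * k ∸ 2 * k
twice-pairsWithinHalves-even k = begin
  2 * p                   ≡⟨ m+n∸n≡m (2 * p) (2 * k) ⟨
  2 * p + 2 * k ∸ 2 * k   ≡⟨ cong (_∸ 2 * k) (*-distribˡ-+ 2 p k) ⟨
  2 * (p + k) ∸ 2 * k     ≡⟨ cong (λ m → 2 * m ∸ 2 * k) (pairsWithinHalves-even k) ⟩
  2 * (k * k) ∸ 2 * k     ≡⟨ cong (_∸ 2 * k) (*-assoc 2 k k) ⟨
  2 * k * k ∸ 2 * k       ∎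
  where
  open ≡-Reasoning
  p = pairsWithinHalves (2 * k)

twice-pairsWithinHalves-odd : ∀ k → 2 * pairsWithinHalves (2 * k + 1) ≡ 2 * k * k
twice-pairsWithinHalves-odd k = trans (cong (2 *_) (pairsWithinHalves-odd k)) (sym (*-assoc 2 k k))

mainTheorem1 : (n : ℕ) → 1 ≤ n → (G : SimpleGraph n) → Z2Cordial G →
    ((k : ℕ) → n ≡ 2 * k → edgeCount G ≤ 2 * k * k ∸ 2 * k + 1)
    × ((k : ℕ) → n ≡ 2 * k + 1 → edgeCount G ≤ 2 * k * k + 1)
mainTheorem1 n _ G cordial = even , odd
  where
  bound : ∀ {m} → n ≡ m → edgeCount G ≤ 2 * pairsWithinHalves m + 1
  bound refl = cordial⇒edgeCount≤ G cordial

  even : (k : ℕ) → n ≡ 2 * k → edgeCount G ≤ 2 * k * k ∸ 2 * k + 1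
  even k n≡2k = subst (λ m → edgeCount G ≤ m + 1) (twice-pairsWithinHalves-even k) (bound n≡2k)

  odd : (k : ℕ) → n ≡ 2 * k + 1 → edgeCount G ≤ 2 * k * k + 1
  odd k n≡2k+1 = subst (λ m → edgeCount G ≤ m + 1) (twice-pairsWithinHalves-odd k) (bound n≡2k+1)
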